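{- Let $r$ be a positive integer, let $G:\mathbf{Set}^r\to\mathbf{Set}$ be a weighted $r$-sort species, and let $g=(g_\Omega)$ be a weight-preserving species isomorphism $G\to G$. Extend $g$ to $E(G)$ by \[ g_{\Omega_1\amalg\cdots\amalg\Omega_k}\big(\{(y_1,\Omega_1),\dots,(y_k,\Omega_k)\}\big)=\{(g_{\Omega_1}(y_1),\Omega_1),\dots,(g_{\Omega_k}(y_k),\Omega_k)\}. \] For disjoint pairs $(\Omega_1,\Omega_2)$ define \[ \eta_{(\Omega_1,\Omega_2)}(x_1,x_2)=x_1\amalg g_{\Omega_2}(x_2),\qquad x_1\in E(G)[\Omega_1],\ x_2\in E(G)[\Omega_2]. \] Then $\eta=(\eta_{(\Omega_1,\Omega_2)})$ is a composition operator for the weighted species $E(G)$.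
   Context: $\mathbf{Set}$ is the category of finite sets and bijections. Objects of $\mathbf{Set}^r$ are $r$-tuples of finite sets; set operations are componentwise, and $\boldsymbol\emptyset=(\emptyset,\dots,\emptyset)$. An $r$-sort species is a functor $F:\mathbf{Set}^r\to\mathbf{Set}$. $E(G)[\Omega]$ is the set of all finite sets $\{(y_1,\Omega_1),\dots,(y_k,\Omega_k)\}$ with $k\ge0$, $\Omega_1\amalg\cdots\amalg\Omega_k=\Omega$, all $\Omega_i\ne\boldsymbol\emptyset$, and $y_i\in G[\Omega_i]$. Morphisms act componentwise via $G$, and $x_1\amalg x_2$ denotes the union of two such sets on disjoint supports. A weighted species $G$ carries a family $w_\Omega:G[\Omega]\to\Lambda$ ($\Lambda$ a commutative ring) with $w_{\boldsymbol\emptyset}\equiv1$ and $w$ invariant under $G[f]$ for all morphisms $f$. $E(G)$ carries the multiplicative weight $w(\{(y_i,\Omega_i)\})=\prod_i w(y_i)$. A species isomorphism $G\to G$ is a family of bijections $g_\Omega:G[\Omega]\to G[\Omega]$ with $g_{\tilde\Omega}\circ G[f]=G[f]\circ g_\Omega$ for all morphisms $f:\Omega\to\tilde\Omega$. It is weight-preserving if there is a ring homomorphism $\lambda$ with $w\circ g_\Omega=\lambda\circ w$. A composition operator for a species $F$ is a family of injective maps $\eta_{(\Omega_1,\Omega_2)}:F[\Omega_1]\times F[\Omega_2]\to F[\Omega_1\amalg\Omega_2]$, for $\Omega_1\cap\Omega_2=\boldsymbol\emptyset$, with the following two properties. - Naturality: $\eta_{(\tilde\Omega_1,\tilde\Omega_2)}\circ(F[f_1]\times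 F[f_2])=F[f_1\amalg f_2]\circ\eta_{(\Omega_1,\Omega_2)}$ for tuples of bijections $f_i:\Omega_i\to\tilde\Omega_i$. - Axiom (D1): whenever $\Omega_1\amalg\Omega_2=\Omega=\tilde\Omega_1\amalg\tilde\Omega_2$, \[ \eta(F[\Omega_1]\times F[\Omega_2])\cap\eta(F[\tilde\Omega_1]\times F[\tilde\Omega_2])=\eta(\eta(F[\Omega_{11}]\times F[\Omega_{12}])\times\eta(F[\Omega_{21}]\times F[\Omega_{22}])), \] where $\Omega_{ij}=\Omega_i\cap\tilde\Omega_j$ and $\eta(A\times B)$ denotes images. -}

module Defs where

open import Level using (Level; _⊔_) renaming (suc to lsuc)
open import Data.Bool using (Bool; true; false; _∨_; _∧_; T)
open import Data.Bool.Properties using (∨-zeroʳ; ∧-identityʳ; ∧-zeroʳ; T-∨; T-∧)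
open import Data.Nat using (ℕ; zero; suc)
open import Data.Fin using (Fin)
open import Data.Vec using (Vec; lookup; zipWith; replicate)
open import Data.Vec.Properties using (lookup-zipWith)
open import Data.List using (List; []; _∷_; _++_)
import Data.List as List
open import Data.List.Properties using (map-++)
open import Data.List.Relation.Unary.All using (All)
open import Data.List.Relation.Unary.Any using (Any)
open import Data.List.Relation.Unary.AllPairs using (AllPairs)
open import Data.List.Relation.Binary.Pointwise using (Pointwise)
open import Data.List.Relation.Binary.Permutation.Propositional using (_↭_)
import Data.List.Relation.Unary.All as All
import Data.List.Relation.Unary.All.Properties as AllP
import Data.List.Relation.Unary.Any.Properties as AnyP
import Data.List.Relation.Unary.AllPairs.Properties as AllPairsP
open import Data.List.Membership.Propositional using (_∈_)
open import Data.List.Membership.Propositional.Properties using (∈-map⁺)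
open import Data.Product using (Σ; Σ-syntax; ∃; ∃-syntax; _×_; _,_; proj₁; proj₂)
open import Data.Sum using (_⊎_; inj₁; inj₂)
open import Data.Empty using (⊥)
open import Function using (_∘_; _$_)
open import Function.Bundles using (_↔_; _⇔_; Equivalence; mk⇔)
import Data.Sum
import Data.Product
open import Relation.Binary.PropositionalEquality
  using (_≡_; refl; sym; trans; cong; subst)
open import Algebra.Bundles using (CommutativeRing)
open import Algebra.Morphism.Structures using (module RingMorphisms)

-- Finite subsets of ℕ, canonically represented (so that ≡ is set
-- equality): a characteristic bit string whose last bit is 1.

-- Nonempty finite subsets of ℕ.
--   one     = {0}
--   b ◂ s   = (if b then {0} else ∅) ∪ { n+1 | n ∈ s }
data NE : Set where
  one : NE
  _◂_ : Bool → NE → NE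

data FinSet : Set where
  ∅ˢ : FinSet
  ne : NE → FinSet

hd : FinSet → Bool
hd ∅ˢ           = false
hd (ne one)     = true
hd (ne (b ◂ s)) = b

tl : FinSet → FinSet
tl ∅ˢ           = ∅ˢ
tl (ne one)     = ∅ˢ
tl (ne (b ◂ s)) = ne s

mem : ℕ → FinSet → Bool
mem zero    A = hd A
mem (suc n) A = mem n (tl A)

cons : Bool → FinSet → FinSet
cons b ∅ˢ     = consˢ b
  where
  consˢ : Bool → FinSet
  consˢ false = ∅ˢ
  consˢ true  = ne one
cons b (ne s) = ne (b ◂ s)

_∪ᴺ_ : NE → NE → NE
one     ∪ᴺ one     = one
one     ∪ᴺ (c ◂ t) = true ◂ t
(b ◂ s) ∪ᴺ one     = true ◂ s
(b ◂ s) ∪ᴺ (c ◂ t) = (b ∨ c) ◂ (s ∪ᴺ t)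

_∪ˢ_ : FinSet → FinSet → FinSet
∅ˢ   ∪ˢ B    = B
ne a ∪ˢ ∅ˢ   = ne a
ne a ∪ˢ ne b = ne (a ∪ᴺ b)

_∩ᴺ_ : NE → NE → FinSet
one     ∩ᴺ one     = ne one
one     ∩ᴺ (c ◂ t) = cons c ∅ˢ
(b ◂ s) ∩ᴺ one     = cons b ∅ˢ
(b ◂ s) ∩ᴺ (c ◂ t) = cons (b ∧ c) (s ∩ᴺ t)

_∩ˢ_ : FinSet → FinSet → FinSet
∅ˢ   ∩ˢ B    = ∅ˢ
ne a ∩ˢ ∅ˢ   = ∅ˢ
ne a ∩ˢ ne b = a ∩ᴺ b

hd-cons : ∀ b A → hd (cons b A) ≡ b
hd-cons false ∅ˢ     = refl
hd-cons true  ∅ˢ     = refl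
hd-cons b     (ne s) = refl

tl-cons : ∀ b A → tl (cons b A) ≡ A
tl-cons false ∅ˢ     = refl
tl-cons true  ∅ˢ     = refl
tl-cons b     (ne s) = refl

hd-∪ : ∀ A B → hd (A ∪ˢ B) ≡ (hd A ∨ hd B)
hd-∪ ∅ˢ B = refl
hd-∪ (ne one) ∅ˢ = refl
hd-∪ (ne (b ◂ s)) ∅ˢ = sym (Data.Bool.Properties.∨-identityʳ b)
hd-∪ (ne one) (ne one) = refl
hd-∪ (ne one) (ne (c ◂ t)) = refl
hd-∪ (ne (b ◂ s)) (ne one) = sym (∨-zeroʳ b)
hd-∪ (ne (b ◂ s)) (ne (c ◂ t)) = refl

∪-identityʳ : ∀ A → A ∪ˢ ∅ˢ ≡ A
∪-identityʳ ∅ˢ     = refl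
∪-identityʳ (ne a) = refl

tl-∪ : ∀ A B → tl (A ∪ˢ B) ≡ (tl A ∪ˢ tl B)
tl-∪ ∅ˢ B = refl
tl-∪ (ne a) ∅ˢ = sym (∪-identityʳ (tl (ne a)))
tl-∪ (ne one) (ne one) = refl
tl-∪ (ne one) (ne (c ◂ t)) = refl
tl-∪ (ne (b ◂ s)) (ne one) = refl
tl-∪ (ne (b ◂ s)) (ne (c ◂ t)) = refl

mem-∪ : ∀ n A B → mem n (A ∪ˢ B) ≡ (mem n A ∨ mem n B)
mem-∪ zero    A B = hd-∪ A B
mem-∪ (suc n) A B = trans (cong (mem n) (tl-∪ A B)) (mem-∪ n (tl A) (tl B))

∩-zeroʳ : ∀ A → A ∩ˢ ∅ˢ ≡ ∅ˢ
∩-zeroʳ ∅ˢ     = refl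
∩-zeroʳ (ne a) = refl

hd-∩ : ∀ A B → hd (A ∩ˢ B) ≡ (hd A ∧ hd B)
hd-∩ ∅ˢ B = refl
hd-∩ (ne a) ∅ˢ = sym (∧-zeroʳ (hd (ne a)))
hd-∩ (ne one) (ne one) = refl
hd-∩ (ne one) (ne (c ◂ t)) = hd-cons c ∅ˢ
hd-∩ (ne (b ◂ s)) (ne one) = trans (hd-cons b ∅ˢ) (sym (∧-identityʳ b))
hd-∩ (ne (b ◂ s)) (ne (c ◂ t)) = hd-cons (b ∧ c) (s ∩ᴺ t)

tl-∩ : ∀ A B → tl (A ∩ˢ B) ≡ (tl A ∩ˢ tl B)
tl-∩ ∅ˢ B = refl
tl-∩ (ne a) ∅ˢ = sym (∩-zeroʳ (tl (ne a)))
tl-∩ (ne one) (ne one) = refl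
tl-∩ (ne one) (ne (c ◂ t)) = tl-cons c ∅ˢ
tl-∩ (ne (b ◂ s)) (ne one) = trans (tl-cons b ∅ˢ) (sym (∩-zeroʳ (ne s)))
tl-∩ (ne (b ◂ s)) (ne (c ◂ t)) = tl-cons (b ∧ c) (s ∩ᴺ t)

mem-∩ : ∀ n A B → mem n (A ∩ˢ B) ≡ (mem n A ∧ mem n B)
mem-∩ zero    A B = hd-∩ A B
mem-∩ (suc n) A B = trans (cong (mem n) (tl-∩ A B)) (mem-∩ n (tl A) (tl B))

-- Objects of Set^r: r-tuples of finite sets (of natural numbers).
-- Componentwise operations.

Obj : ℕ → Set
Obj r = Vec FinSet r

module _ {r : ℕ} where

  ∅ : Obj r
  ∅ = replicate r ∅ˢ

  _∪_ : Obj r → Obj r → Obj r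
  _∪_ = zipWith _∪ˢ_

  _∩_ : Obj r → Obj r → Obj r
  _∩_ = zipWith _∩ˢ_

  record _∋[_]_ (Ω : Obj r) (i : Fin r) (x : ℕ) : Set where
    constructor in!
    field prf : T (mem x (lookup Ω i))

  Disjoint : Obj r → Obj r → Set
  Disjoint A B = ∀ i x → A ∋[ i ] x → B ∋[ i ] x → ⊥

  NonEmpty : Obj r → Set
  NonEmpty A = ∃[ i ] ∃[ x ] A ∋[ i ] x

  private
    T∪ : ∀ A B i x → T (mem x (lookup (A ∪ B) i)) ⇔
                     (T (mem x (lookup A i)) ⊎ T (mem x (lookup B i)))
    T∪ A B i x
      rewrite lookup-zipWith _∪ˢ_ i A B | mem-∪ x (lookup A i) (lookup B i) = T-∨

    T∩ : ∀ A B i x → T (mem x (lookup (A ∩ B) i)) ⇔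
                     (T (mem x (lookup A i)) × T (mem x (lookup B i)))
    T∩ A B i x
      rewrite lookup-zipWith _∩ˢ_ i A B | mem-∩ x (lookup A i) (lookup B i) = T-∧

  ∈-∪⇔ : ∀ A B i x → (A ∪ B) ∋[ i ] x ⇔ (A ∋[ i ] x ⊎ B ∋[ i ] x)
  ∈-∪⇔ A B i x = mk⇔
    (λ p → Data.Sum.map in! in! (Equivalence.to (T∪ A B i x) (_∋[_]_.prf p)))
    (λ q → in! (Equivalence.from (T∪ A B i x)
                 (Data.Sum.map _∋[_]_.prf _∋[_]_.prf q)))

  ∈-∩⇔ : ∀ A B i x → (A ∩ B) ∋[ i ] x ⇔ (A ∋[ i ] x × B ∋[ i ] x)
  ∈-∩⇔ A B i x = mk⇔
    (λ p → Data.Product.map in! in! (Equivalence.to (T∩ A B i x) (_∋[_]_.prf p)))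
    (λ q → in! (Equivalence.from (T∩ A B i x)
                 (Data.Product.map _∋[_]_.prf _∋[_]_.prf q)))

  -- Morphisms of Set^r: tuples of bijections Ω_i → Ω'_i (one per sort),
  -- given by functions on the ambient ℕ; only their values on Ω matter
  -- (species are required to respect agreement on Ω, see map-cong).
  record Mor (Ω Ω' : Obj r) : Set where
    field
      to       : Fin r → ℕ → ℕ
      from     : Fin r → ℕ → ℕ
      to-∈     : ∀ i x → Ω ∋[ i ] x → Ω' ∋[ i ] (to i x)
      from-∈   : ∀ i y → Ω' ∋[ i ] y → Ω ∋[ i ] (from i y)
      from-to  : ∀ i x → Ω ∋[ i ] x → from i (to i x) ≡ x
      to-from  : ∀ i y → Ω' ∋[ i ] y → to i (from i y) ≡ y
  open Mor public

  AgreeOn : Obj r → (Fin r → ℕ → ℕ) → (Fin r → ℕ → ℕ) → Set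
  AgreeOn Ω φ ψ = ∀ i x → Ω ∋[ i ] x → φ i x ≡ ψ i x

  idM : (Ω : Obj r) → Mor Ω Ω
  idM Ω = record
    { to = λ _ x → x ; from = λ _ x → x
    ; to-∈ = λ _ _ p → p ; from-∈ = λ _ _ p → p
    ; from-to = λ _ _ _ → refl ; to-from = λ _ _ _ → refl }

  _∘M_ : ∀ {Ω Ω' Ω''} → Mor Ω' Ω'' → Mor Ω Ω' → Mor Ω Ω''
  _∘M_ {Ω} {Ω'} {Ω''} g f = record
    { to = λ i x → to g i (to f i x)
    ; from = λ i y → from f i (from g i y)
    ; to-∈ = λ i x p → to-∈ g i _ (to-∈ f i x p)
    ; from-∈ = λ i y p → from-∈ f i _ (from-∈ g i y p)
    ; from-to = λ i x p →
        trans (cong (from f i) (from-to g i _ (to-∈ f i x p))) (from-to f i x p)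
    ; to-from = λ i y p →
        trans (cong (to g i) (to-from f i _ (from-∈ g i y p))) (to-from g i y p) }

record Species (r : ℕ) : Set₁ where
  field
    F        : Obj r → Set
    finite   : ∀ Ω → Σ[ n ∈ ℕ ] (F Ω ↔ Fin n)
    map      : ∀ {Ω Ω'} → Mor Ω Ω' → F Ω → F Ω'
    map-cong : ∀ {Ω Ω'} (f f' : Mor Ω Ω') → AgreeOn Ω (to f) (to f') →
               ∀ y → map f y ≡ map f' y
    map-id   : ∀ {Ω} y → map (idM Ω) y ≡ y
    map-∘    : ∀ {Ω Ω' Ω''} (g : Mor Ω' Ω'') (f : Mor Ω Ω') y →
               map (g ∘M f) y ≡ map g (map f y)

record WeightedSpecies {c ℓ} (r : ℕ) (Λ : CommutativeRing c ℓ) : Set (lsuc Level.zero ⊔ c ⊔ ℓ) where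
  open CommutativeRing Λ using (Carrier; _≈_; 1#)
  field
    species : Species r
  open Species species public
  field
    w     : ∀ {Ω} → F Ω → Carrier
    w-∅   : (y : F ∅) → w y ≈ 1#
    w-inv : ∀ {Ω Ω'} (f : Mor Ω Ω') (y : F Ω) → w (map f y) ≈ w y

record SpeciesIso {r : ℕ} (G : Species r) : Set where
  open Species G
  field
    fun     : ∀ {Ω} → F Ω → F Ω
    inv     : ∀ {Ω} → F Ω → F Ω
    inv-fun : ∀ {Ω} (y : F Ω) → inv (fun y) ≡ y
    fun-inv : ∀ {Ω} (y : F Ω) → fun (inv y) ≡ y
    natural : ∀ {Ω Ω'} (f : Mor Ω Ω') (y : F Ω) → fun (map f y) ≡ map f (fun y)

WeightPreserving : ∀ {c ℓ r} {Λ : CommutativeRing c ℓ} (G : WeightedSpecies r Λ) →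
                   SpeciesIso (WeightedSpecies.species G) → Set (c ⊔ ℓ)
WeightPreserving {Λ = Λ} G g =
  Σ[ λ′ ∈ (Carrier → Carrier) ]
    (RingMorphisms.IsRingHomomorphism rawRing rawRing λ′ ×
     (∀ {Ω} (y : F Ω) → w (SpeciesIso.fun g y) ≈ λ′ (w y)))
  where
  open CommutativeRing Λ using (Carrier; _≈_; rawRing)
  open WeightedSpecies G using (F; w)

IsPartition : ∀ {r} → Obj r → List (Obj r) → Set
IsPartition Ω os =
  All NonEmpty os × AllPairs Disjoint os ×
  (∀ i x → Ω ∋[ i ] x ⇔ Any (λ o → o ∋[ i ] x) os)

private
  any-∈ : ∀ {r} {os : List (Obj r)} {i x} → Any (λ o → o ∋[ i ] x) os →
          ∃[ o ] (o ∈ os × o ∋[ i ] x)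
  any-∈ (Any.here p)  = _ , Any.here refl , p
  any-∈ (Any.there p) with any-∈ p
  ... | o , m , q = o , Any.there m , q

  ∈-any : ∀ {r} {os : List (Obj r)} {o i x} → o ∈ os → o ∋[ i ] x →
          Any (λ o → o ∋[ i ] x) os
  ∈-any (Any.here refl) p = Any.here p
  ∈-any (Any.there m)   p = Any.there (∈-any m p)

partition-++ : ∀ {r} {A B : Obj r} {os₁ os₂} → Disjoint A B →
               IsPartition A os₁ → IsPartition B os₂ →
               IsPartition (A ∪ B) (os₁ ++ os₂)
partition-++ {A = A} {B} {os₁} {os₂} d (n₁ , p₁ , m₁) (n₂ , p₂ , m₂) =
  AllP.++⁺ n₁ n₂ ,
  AllPairsP.++⁺ p₁ p₂
    (All.tabulate λ {o₁} o₁∈ → All.tabulate λ {o₂} o₂∈ i x x₁ x₂ →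
      d i x (Equivalence.from (m₁ i x) (∈-any o₁∈ x₁))
            (Equivalence.from (m₂ i x) (∈-any o₂∈ x₂))) ,
  λ i x → record
    { to = λ p → Data.Sum.[ (λ a → AnyP.++⁺ˡ (Equivalence.to (m₁ i x) a))
                          , (λ b → AnyP.++⁺ʳ os₁ (Equivalence.to (m₂ i x) b)) ]
                          (Equivalence.to (∈-∪⇔ A B i x) p)
    ; from = λ q → Equivalence.from (∈-∪⇔ A B i x)
        (Data.Sum.[ (λ a → inj₁ (Equivalence.from (m₁ i x) a))
                  , (λ b → inj₂ (Equivalence.from (m₂ i x) b)) ] (AnyP.++⁻ os₁ q))
    ; to-cong = λ { refl → refl } ; from-cong = λ { refl → refl } }

-- A finite set of blocks is represented by a list of blocks; two
-- representatives denote the same set iff they are permutations of each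
-- other (_≈E_).  E(G)[Ω] is thus the setoid (EG G Ω , _≈E_).

module E {r : ℕ} (G : Species r) where
  open Species G

  Block : Set
  Block = Σ (Obj r) F

  EG : Obj r → Set
  EG Ω = Σ[ bs ∈ List Block ] IsPartition Ω (List.map proj₁ bs)

  _≈E_ : ∀ {Ω} → EG Ω → EG Ω → Set
  x ≈E x' = proj₁ x ↭ proj₁ x'

  -- graph of E(G)[f]:  E(G)[f] {(y_i,Ω_i)} = {(G[f|Ω_i] y_i , f(Ω_i))}
  BlockRel : ∀ {Ω Ω'} → Mor Ω Ω' → Block → Block → Set
  BlockRel f (Ωi , y) (Ωi' , y') =
    Σ[ q ∈ Mor Ωi Ωi' ] (AgreeOn Ωi (to q) (to f) × map q y ≡ y')

  EMap : ∀ {Ω Ω'} → Mor Ω Ω' → EG Ω → EG Ω' → Set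
  EMap f x z = Σ[ L ∈ List Block ] (Pointwise (BlockRel f) (proj₁ x) L × L ↭ proj₁ z)

  module _ (g : SpeciesIso G) where
    gb : Block → Block
    gb b = proj₁ b , SpeciesIso.fun g (proj₂ b)

    gE : ∀ {Ω} → EG Ω → EG Ω
    gE {Ω} (bs , p) =
      List.map gb bs ,
      subst (IsPartition Ω) (Data.List.Properties.map-∘ bs) p

    η : ∀ {Ω₁ Ω₂} → Disjoint Ω₁ Ω₂ → EG Ω₁ → EG Ω₂ → EG (Ω₁ ∪ Ω₂)
    η {Ω₁} {Ω₂} d (bs₁ , p₁) x₂ with gE x₂
    ... | (bs₂ , p₂) =
      bs₁ ++ bs₂ ,
      subst (IsPartition (Ω₁ ∪ Ω₂)) (sym (map-++ proj₁ bs₁ bs₂))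
            (partition-++ d p₁ p₂)

-- Disjointness facts needed to even write down axiom (D1)

module _ {r : ℕ} where
  private
    ∩l : ∀ {A B : Obj r} {i x} → (A ∩ B) ∋[ i ] x → A ∋[ i ] x
    ∩l {A} {B} {i} {x} p = proj₁ (Equivalence.to (∈-∩⇔ A B i x) p)
    ∩r : ∀ {A B : Obj r} {i x} → (A ∩ B) ∋[ i ] x → B ∋[ i ] x
    ∩r {A} {B} {i} {x} p = proj₂ (Equivalence.to (∈-∩⇔ A B i x) p)

  disj-row : (A : Obj r) {Ω̃₁ Ω̃₂ : Obj r} → Disjoint Ω̃₁ Ω̃₂ →
             Disjoint (A ∩ Ω̃₁) (A ∩ Ω̃₂)
  disj-row A d̃ i x p q = d̃ i x (∩r p) (∩r q)

  disj-cols : {Ω₁ Ω₂ : Obj r} (Ω̃₁ Ω̃₂ : Obj r) → Disjoint Ω₁ Ω₂ →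
              Disjoint ((Ω₁ ∩ Ω̃₁) ∪ (Ω₁ ∩ Ω̃₂)) ((Ω₂ ∩ Ω̃₁) ∪ (Ω₂ ∩ Ω̃₂))
  disj-cols {Ω₁} {Ω₂} Ω̃₁ Ω̃₂ d i x p q =
    d i x (Data.Sum.[ ∩l , ∩l ] (Equivalence.to (∈-∪⇔ (Ω₁ ∩ Ω̃₁) (Ω₁ ∩ Ω̃₂) i x) p))
          (Data.Sum.[ ∩l , ∩l ] (Equivalence.to (∈-∪⇔ (Ω₂ ∩ Ω̃₁) (Ω₂ ∩ Ω̃₂) i x) q))

-- Composition operators (for a species whose value sets are given as
-- setoids (F Ω , _≈_) with functorial action given by its graph Map).

record IsCompositionOperator {r : ℕ}
    (F    : Obj r → Set)
    (_≈_  : ∀ {Ω} → F Ω → F Ω → Set)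
    (Map  : ∀ {Ω Ω'} → Mor Ω Ω' → F Ω → F Ω' → Set)
    (η    : ∀ {Ω₁ Ω₂} → Disjoint Ω₁ Ω₂ → F Ω₁ → F Ω₂ → F (Ω₁ ∪ Ω₂)) : Set where
  Image : ∀ {Ω₁ Ω₂ Ω} → Disjoint Ω₁ Ω₂ → Ω₁ ∪ Ω₂ ≡ Ω → F Ω → Set
  Image {Ω₁} {Ω₂} d e x = ∃[ x₁ ] ∃[ x₂ ] (subst F e (η d x₁ x₂) ≈ x)
  field
    well-defined : ∀ {Ω₁ Ω₂} (d : Disjoint Ω₁ Ω₂) {x₁ x₁' : F Ω₁} {x₂ x₂' : F Ω₂} →
                   x₁ ≈ x₁' → x₂ ≈ x₂' → η d x₁ x₂ ≈ η d x₁' x₂'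
    injective    : ∀ {Ω₁ Ω₂} (d : Disjoint Ω₁ Ω₂) {x₁ x₁' : F Ω₁} {x₂ x₂' : F Ω₂} →
                   η d x₁ x₂ ≈ η d x₁' x₂' → (x₁ ≈ x₁') × (x₂ ≈ x₂')
    -- naturality; h is f₁ ∐ f₂ (the morphism restricting to f₁ and f₂)
    naturality   : ∀ {Ω₁ Ω₂ Ω̃₁ Ω̃₂} (d : Disjoint Ω₁ Ω₂) (d̃ : Disjoint Ω̃₁ Ω̃₂)
                   (f₁ : Mor Ω₁ Ω̃₁) (f₂ : Mor Ω₂ Ω̃₂) (h : Mor (Ω₁ ∪ Ω₂) (Ω̃₁ ∪ Ω̃₂)) →
                   AgreeOn Ω₁ (to h) (to f₁) → AgreeOn Ω₂ (to h) (to f₂) →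
                   ∀ x₁ x₂ y₁ y₂ z → Map f₁ x₁ y₁ → Map f₂ x₂ y₂ →
                   Map h (η d x₁ x₂) z → z ≈ η d̃ y₁ y₂
    D1 : ∀ {Ω₁ Ω₂ Ω̃₁ Ω̃₂ Ω} (d : Disjoint Ω₁ Ω₂) (d̃ : Disjoint Ω̃₁ Ω̃₂)
         (e : Ω₁ ∪ Ω₂ ≡ Ω) (ẽ : Ω̃₁ ∪ Ω̃₂ ≡ Ω) (x : F Ω) →
         (Image d e x × Image d̃ ẽ x) ⇔
         (Σ[ e′ ∈ ((Ω₁ ∩ Ω̃₁) ∪ (Ω₁ ∩ Ω̃₂)) ∪ ((Ω₂ ∩ Ω̃₁) ∪ (Ω₂ ∩ Ω̃₂)) ≡ Ω ]
          ∃[ x₁₁ ] ∃[ x₁₂ ] ∃[ x₂₁ ] ∃[ x₂₂ ]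
            (subst F e′ (η (disj-cols Ω̃₁ Ω̃₂ d)
                           (η (disj-row Ω₁ d̃) x₁₁ x₁₂)
                           (η (disj-row Ω₂ d̃) x₂₁ x₂₂)) ≈ x))

module Submission where

open import Defs
open import Data.Nat using (ℕ; _≤_)
open import Algebra.Bundles using (CommutativeRing)

open import Data.Nat using (zero; suc)
open import Data.Bool using (true; false; T)
open import Data.Unit using (tt)
open import Data.Empty using (⊥; ⊥-elim)
open import Data.Fin using (Fin) renaming (zero to fzero; suc to fsuc)
open import Data.Vec using ([]; _∷_; lookup)
open import Data.Vec.Properties using (tabulate∘lookup; tabulate-cong)
open import Data.Product using (Σ-syntax; ∃-syntax; _×_; _,_; proj₁; proj₂)
open import Data.Product.Function.NonDependent.Propositional using (_×-⇔_)
open import Data.Sum using (_⊎_; inj₁; inj₂; [_,_])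
import Data.Sum as Sum
open import Data.List using (List; []; _∷_; _++_; map; filter)
import Data.List.Properties as List
import Data.List.Relation.Unary.All as All
import Data.List.Relation.Unary.All.Properties as All
import Data.List.Relation.Unary.Any.Properties as Any
import Data.List.Relation.Unary.AllPairs.Properties as AllPairs
open import Data.List.Relation.Unary.Any using (Any; here; there)
open import Data.List.Relation.Binary.Pointwise as Pointwise using (Pointwise; []; _∷_)
open import Data.List.Relation.Binary.Permutation.Propositional
  using (_↭_; prep; ↭-refl; ↭-sym; ↭-trans; module PermutationReasoning)
import Data.List.Relation.Binary.Permutation.Propositional.Properties as Perm
open import Data.List.Membership.Propositional using (_∈_; find; lose)
open import Data.List.Membership.Propositional.Properties
  using (∈-filter⁺; ∈-filter⁻; ∈-++⁺ˡ; ∈-++⁺ʳ; ∈-++⁻)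
open import Function.Bundles using (_⇔_; Equivalence; mk⇔)
import Function.Properties.Equivalence as ⇔
open import Relation.Binary.PropositionalEquality
  using (_≡_; refl; sym; trans; cong; cong₂; subst; subst₂; module ≡-Reasoning)
open import Relation.Nullary using (¬_; Dec; yes; no)
import Relation.Nullary.Decidable as Dec
open import Relation.Unary using (Decidable)

-- A structure x ∈ E(G)[Ω] is a list of blocks (Ωᵢ , yᵢ) whose
-- supports partition Ω, taken up to permutation, and η(x₁ , x₂) = x₁ ∐ g(x₂).
-- Since g is invertible on G, x lies in the image of η_(Ω₁,Ω₂) exactly when
-- its blocks split into a partition of Ω₁ and a partition of Ω₂.  Because
-- the blocks of a structure are nonempty and pairwise disjoint, such a split
-- is unique: it is recovered by selecting the blocks meeting Ω₁.  This gives
-- injectivity; well-definedness and naturality are blockwise computations.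
-- For (D1), a list split both along (Ω₁,Ω₂) and along (Ω̃₁,Ω̃₂) has each
-- block inside some Ωᵢ ∩ Ω̃ⱼ, so refining each half of the first split by
-- the second yields a four-fold split; conversely a four-fold split
-- regroups into both two-fold splits.

mem-∅ : ∀ n → mem n ∅ˢ ≡ false
mem-∅ zero    = refl
mem-∅ (suc n) = mem-∅ n

ne-member : ∀ s → ∃[ n ] T (mem n (ne s))
ne-member one         = zero , tt
ne-member (true ◂ s)  = zero , tt
ne-member (false ◂ s) = let n , p = ne-member s in suc n , p

finSet-ext : ∀ X Y → (∀ n → mem n X ≡ mem n Y) → X ≡ Y
finSet-ext ∅ˢ ∅ˢ H = refl
finSet-ext ∅ˢ (ne s) H = ⊥-elim (∅-has-no-member s H)
  where
  ∅-has-no-member : ∀ s → (∀ n → mem n ∅ˢ ≡ mem n (ne s)) → ⊥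
  ∅-has-no-member s H =
    let n , p = ne-member s in subst T (trans (sym (H n)) (mem-∅ n)) p
finSet-ext (ne s) ∅ˢ H = sym (finSet-ext ∅ˢ (ne s) (λ n → sym (H n)))
finSet-ext (ne one) (ne one) H = refl
finSet-ext (ne one) (ne (c ◂ t)) H
  with () ← finSet-ext ∅ˢ (ne t) (λ n → H (suc n))
finSet-ext (ne (b ◂ s)) (ne one) H
  with () ← finSet-ext ∅ˢ (ne s) (λ n → sym (H (suc n)))
finSet-ext (ne (b ◂ s)) (ne (c ◂ t)) H
  with refl ← H zero | refl ← finSet-ext (ne s) (ne t) (λ n → H (suc n)) = refl

T-ext : ∀ a b → (T a → T b) → (T b → T a) → a ≡ b
T-ext false false _ _ = refl
T-ext false true  _ g = ⊥-elim (g tt)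
T-ext true  false f _ = ⊥-elim (f tt)
T-ext true  true  _ _ = refl

nonEmpty? : ∀ {r} (A : Obj r) → Dec (NonEmpty A)
nonEmpty? []         = no λ { (() , _) }
nonEmpty? (ne s ∷ A) = let n , p = ne-member s in yes (fzero , n , in! p)
nonEmpty? (∅ˢ ∷ A)   = Dec.map′ later earlier (nonEmpty? A)
  where
  later : NonEmpty A → NonEmpty (∅ˢ ∷ A)
  later (i , n , in! p) = fsuc i , n , in! p
  earlier : NonEmpty (∅ˢ ∷ A) → NonEmpty A
  earlier (fzero , n , in! p)  = ⊥-elim (subst T (mem-∅ n) p)
  earlier (fsuc i , n , in! p) = i , n , in! p

module _ {r : ℕ} where

  infix 4 _⊆_
  _⊆_ : Obj r → Obj r → Set
  A ⊆ B = ∀ i n → A ∋[ i ] n → B ∋[ i ] n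

  ⊆-antisym : {A B : Obj r} → A ⊆ B → B ⊆ A → A ≡ B
  ⊆-antisym {A} {B} A⊆B B⊆A =
    trans (sym (tabulate∘lookup A)) (trans (tabulate-cong same-sort) (tabulate∘lookup B))
    where
    same-sort : ∀ i → lookup A i ≡ lookup B i
    same-sort i = finSet-ext _ _ λ n → T-ext _ _
      (λ p → _∋[_]_.prf (A⊆B i n (in! p))) (λ p → _∋[_]_.prf (B⊆A i n (in! p)))

  module _ {A B : Obj r} {i : Fin r} {n : ℕ} where
    ∪⁺ : A ∋[ i ] n ⊎ B ∋[ i ] n → (A ∪ B) ∋[ i ] n
    ∪⁺ = Equivalence.from (∈-∪⇔ A B i n)
    ∪⁻ : (A ∪ B) ∋[ i ] n → A ∋[ i ] n ⊎ B ∋[ i ] n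
    ∪⁻ = Equivalence.to (∈-∪⇔ A B i n)
    ∩⁺ : A ∋[ i ] n → B ∋[ i ] n → (A ∩ B) ∋[ i ] n
    ∩⁺ p q = Equivalence.from (∈-∩⇔ A B i n) (p , q)
    ∩⁻ : (A ∩ B) ∋[ i ] n → A ∋[ i ] n × B ∋[ i ] n
    ∩⁻ = Equivalence.to (∈-∩⇔ A B i n)

  private variable A B C D Ω₁ Ω₂ Ω̃₁ Ω̃₂ : Obj r

  ∪-⊆ˡ : A ⊆ A ∪ B
  ∪-⊆ˡ _ _ p = ∪⁺ (inj₁ p)

  ∪-⊆ʳ : B ⊆ A ∪ B
  ∪-⊆ʳ _ _ p = ∪⁺ (inj₂ p)

  ∪-⊆ : A ⊆ C → B ⊆ C → A ∪ B ⊆ C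
  ∪-⊆ A⊆C B⊆C i n p = [ A⊆C i n , B⊆C i n ] (∪⁻ p)

  ∩-⊆ˡ : A ∩ B ⊆ A
  ∩-⊆ˡ _ _ p = proj₁ (∩⁻ p)

  ∩-⊆ʳ : A ∩ B ⊆ B
  ∩-⊆ʳ _ _ p = proj₂ (∩⁻ p)

  ⊆-∩ : C ⊆ A → C ⊆ B → C ⊆ A ∩ B
  ⊆-∩ C⊆A C⊆B i n p = ∩⁺ (C⊆A i n p) (C⊆B i n p)

  ∩-comm : (A B : Obj r) → A ∩ B ≡ B ∩ A
  ∩-comm A B = ⊆-antisym (⊆-∩ ∩-⊆ʳ ∩-⊆ˡ) (⊆-∩ ∩-⊆ʳ ∩-⊆ˡ)

  ∩-distrib-cover : A ⊆ B ∪ C → (A ∩ B) ∪ (A ∩ C) ≡ A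
  ∩-distrib-cover A⊆B∪C = ⊆-antisym (∪-⊆ ∩-⊆ˡ ∩-⊆ˡ)
    (λ i n p → ∪⁺ (Sum.map (∩⁺ p) (∩⁺ p) (∪⁻ (A⊆B∪C i n p))))

  ∩-distrib-coverʳ : C ⊆ A ∪ B → (A ∩ C) ∪ (B ∩ C) ≡ C
  ∩-distrib-coverʳ {C} {A} {B} C⊆A∪B =
    trans (cong₂ _∪_ (∩-comm A C) (∩-comm B C)) (∩-distrib-cover C⊆A∪B)

  disjoint-sym : Disjoint A B → Disjoint B A
  disjoint-sym d i n p q = d i n q p

  disjoint-∩ : Disjoint A B → Disjoint (A ∩ C) (B ∩ C)
  disjoint-∩ d i n p q = d i n (∩-⊆ˡ i n p) (∩-⊆ˡ i n q)

  module _ (e : Ω₁ ∪ Ω₂ ≡ Ω̃₁ ∪ Ω̃₂) where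
    cells-left : (Ω₁ ∩ Ω̃₁) ∪ (Ω₁ ∩ Ω̃₂) ≡ Ω₁
    cells-left = ∩-distrib-cover (subst (Ω₁ ⊆_) e ∪-⊆ˡ)

    cells-right : (Ω₂ ∩ Ω̃₁) ∪ (Ω₂ ∩ Ω̃₂) ≡ Ω₂
    cells-right = ∩-distrib-cover (subst (Ω₂ ⊆_) e ∪-⊆ʳ)

    cells-top : (Ω₁ ∩ Ω̃₁) ∪ (Ω₂ ∩ Ω̃₁) ≡ Ω̃₁
    cells-top = ∩-distrib-coverʳ (subst (Ω̃₁ ⊆_) (sym e) ∪-⊆ˡ)

    cells-bottom : (Ω₁ ∩ Ω̃₂) ∪ (Ω₂ ∩ Ω̃₂) ≡ Ω̃₂
    cells-bottom = ∩-distrib-coverʳ (subst (Ω̃₂ ⊆_) (sym e) ∪-⊆ʳ)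

  codomain-unique : (q : Mor A B) (q′ : Mor A C) → AgreeOn A (to q) (to q′) → B ≡ C
  codomain-unique q q′ agree =
    ⊆-antisym (image-⊆ q q′ agree) (image-⊆ q′ q λ i n p → sym (agree i n p))
    where
    image-⊆ : ∀ {B C} (q : Mor A B) (q′ : Mor A C) → AgreeOn A (to q) (to q′) → B ⊆ C
    image-⊆ {C = C} q q′ agree i n p =
      subst (C ∋[ i ]_) (trans (sym (agree i _ (from-∈ q i n p))) (to-from q i n p))
            (to-∈ q′ i _ (from-∈ q i n p))

  Meets : Obj r → Obj r → Set
  Meets o A = NonEmpty (o ∩ A)

  meets-mono : A ⊆ B → Meets C A → Meets C B
  meets-mono A⊆B (i , n , p) = i , n , ∩⁺ (proj₁ (∩⁻ p)) (A⊆B i n (proj₂ (∩⁻ p)))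

  nonempty-meets : NonEmpty C → C ⊆ A → Meets C A
  nonempty-meets (i , n , p) C⊆A = i , n , ∩⁺ p (C⊆A i n p)

  disjoint-¬meets : Disjoint A B → C ⊆ B → ¬ Meets C A
  disjoint-¬meets d C⊆B (i , n , p) = d i n (proj₂ (∩⁻ p)) (C⊆B i n (proj₁ (∩⁻ p)))

  meets-side : Disjoint C D → A ⊆ C ⊎ A ⊆ D → Meets A C → A ⊆ C
  meets-side d (inj₁ A⊆C) _  = A⊆C
  meets-side d (inj₂ A⊆D) mC = ⊥-elim (disjoint-¬meets d A⊆D mC)

module _ {a p q} {X : Set a} {P : X → Set p} {Q : X → Set q}
         (P? : Decidable P) (Q? : Decidable Q) where

  filter-split : ∀ xs → (∀ {x} → x ∈ xs → P x ⊎ Q x) → (∀ {x} → x ∈ xs → P x → ¬ Q x) →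
                 filter P? xs ++ filter Q? xs ↭ xs
  filter-split []       _   _    = ↭-refl
  filter-split (x ∷ xs) cover excl
    with P? x | Q? x | filter-split xs (λ m → cover (there m)) (λ m → excl (there m))
  ... | yes px | yes qx | _    = ⊥-elim (excl (here refl) px qx)
  ... | yes _  | no  _  | rest = prep x rest
  ... | no  _  | yes _  | rest = ↭-trans (Perm.shift x (filter P? xs) (filter Q? xs)) (prep x rest)
  ... | no ¬px | no ¬qx | _    = ⊥-elim ([ ¬px , ¬qx ] (cover (here refl)))

++-interchange : ∀ {a} {X : Set a} (P Q R S : List X) →
                 (P ++ Q) ++ (R ++ S) ↭ (P ++ R) ++ (Q ++ S)
++-interchange P Q R S = begin
  (P ++ Q) ++ (R ++ S)  ≡⟨ List.++-assoc P Q (R ++ S) ⟩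
  P ++ (Q ++ (R ++ S))  ↭⟨ Perm.++⁺ˡ P (Perm.shifts Q R) ⟩
  P ++ (R ++ (Q ++ S))  ≡⟨ List.++-assoc P R (Q ++ S) ⟨
  (P ++ R) ++ (Q ++ S)  ∎
  where open PermutationReasoning

pointwise-++⁻ : ∀ {a b ℓ} {X : Set a} {Y : Set b} {R : X → Y → Set ℓ} xs ys {zs} →
                Pointwise R (xs ++ ys) zs →
                ∃[ zs₁ ] ∃[ zs₂ ] (zs ≡ zs₁ ++ zs₂ × Pointwise R xs zs₁ × Pointwise R ys zs₂)
pointwise-++⁻ []       ys rs       = [] , _ , refl , [] , rs
pointwise-++⁻ (x ∷ xs) ys (r ∷ rs) =
  let zs₁ , zs₂ , eq , rs₁ , rs₂ = pointwise-++⁻ xs ys rs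
  in _ ∷ zs₁ , zs₂ , cong (_ ∷_) eq , r ∷ rs₁ , rs₂

module CompositionOfE {r : ℕ} (G : Species r) (g : SpeciesIso G) where
  open Species G using (F; map-cong) renaming (map to mapᴳ)
  open SpeciesIso g using (fun; inv; fun-inv; inv-fun; natural)
  open E G

  private variable A B C D Ω Ω₁ Ω₂ Ω̃₁ Ω̃₂ : Obj r

  blocks : EG Ω → List Block
  blocks = proj₁

  Partitions : Obj r → List Block → Set
  Partitions Ω L = IsPartition Ω (map proj₁ L)

  block-⊆ : ∀ {L b} → Partitions A L → b ∈ L → proj₁ b ⊆ A
  block-⊆ P m i n p = Equivalence.from (proj₂ (proj₂ P) i n) (Any.map⁺ (lose m p))

  block-nonempty : ∀ {L b} → Partitions A L → b ∈ L → NonEmpty (proj₁ b)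
  block-nonempty P m = All.lookup (All.map⁻ (proj₁ P)) m

  Partitions-++ : ∀ {us vs} → Disjoint A B → Partitions A us → Partitions B vs →
                  Partitions (A ∪ B) (us ++ vs)
  Partitions-++ {us = us} {vs} d P Q =
    subst (IsPartition _) (sym (List.map-++ proj₁ us vs)) (partition-++ d P Q)

  meets? : (A : Obj r) → Decidable (λ (b : Block) → Meets (proj₁ b) A)
  meets? A b = nonEmpty? (proj₁ b ∩ A)

  restrict : ∀ {T L} → Partitions A L → T ⊆ A →
             (∀ {b} → b ∈ L → Meets (proj₁ b) T → proj₁ b ⊆ T) →
             Partitions T (filter (meets? T) L)
  restrict {T = T} {L} P T⊆A inside =
    All.map⁺ (All.filter⁺ (meets? T) (All.map⁻ (proj₁ P))) ,
    AllPairs.map⁺ (AllPairs.filter⁺ (meets? T) (AllPairs.map⁻ (proj₁ (proj₂ P)))) ,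
    λ i n → mk⇔ (covered i n) (contained i n)
    where
    covered : ∀ i n → T ∋[ i ] n → Any (_∋[ i ] n) (map proj₁ (filter (meets? T) L))
    covered i n t =
      let b , m , q = find (Any.map⁻ (Equivalence.to (proj₂ (proj₂ P) i n) (T⊆A i n t)))
      in Any.map⁺ (lose (∈-filter⁺ (meets? T) m (i , n , ∩⁺ q t)) q)
    contained : ∀ i n → Any (_∋[ i ] n) (map proj₁ (filter (meets? T) L)) → T ∋[ i ] n
    contained i n a =
      let b , m , q = find (Any.map⁻ a)
          m′ , meets = ∈-filter⁻ (meets? T) m
      in inside m′ meets i n q

  filter-inside : ∀ {L} → Partitions A L → filter (meets? A) L ≡ L
  filter-inside P = List.filter-all (meets? _)
    (All.tabulate λ m → nonempty-meets (block-nonempty P m) (block-⊆ P m))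

  filter-outside : ∀ {L} → Disjoint A B → Partitions B L → filter (meets? A) L ≡ []
  filter-outside d P = List.filter-none (meets? _)
    (All.tabulate λ m → disjoint-¬meets d (block-⊆ P m))

  select-left : ∀ {us vs} → Disjoint A B → Partitions A us → Partitions B vs →
                filter (meets? A) (us ++ vs) ≡ us
  select-left {A = A} {us = us} {vs} d P Q = begin
    filter (meets? A) (us ++ vs)
      ≡⟨ List.filter-++ (meets? A) us vs ⟩
    filter (meets? A) us ++ filter (meets? A) vs
      ≡⟨ cong₂ _++_ (filter-inside P) (filter-outside d Q) ⟩
    us ++ []
      ≡⟨ List.++-identityʳ us ⟩
    us
      ∎
    where open ≡-Reasoning

  select-right : ∀ {us vs} → Disjoint A B → Partitions A us → Partitions B vs →
                 filter (meets? B) (us ++ vs) ≡ vs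
  select-right {B = B} {us = us} {vs} d P Q =
    trans (List.filter-++ (meets? B) us vs)
          (cong₂ _++_ (filter-outside (disjoint-sym d) P) (filter-inside Q))

  cancel-partitions : ∀ {us vs us′ vs′} → Disjoint A B →
                      Partitions A us → Partitions B vs → Partitions A us′ → Partitions B vs′ →
                      us ++ vs ↭ us′ ++ vs′ → (us ↭ us′) × (vs ↭ vs′)
  cancel-partitions {A = A} {B} d P Q P′ Q′ σ =
    subst₂ _↭_ (select-left d P Q) (select-left d P′ Q′) (Perm.filter-↭ (meets? A) σ) ,
    subst₂ _↭_ (select-right d P Q) (select-right d P′ Q′) (Perm.filter-↭ (meets? B) σ)

  Split : Obj r → Obj r → List Block → Set
  Split C D xs = ∃[ us ] ∃[ vs ] (Partitions C us × Partitions D vs × us ++ vs ↭ xs)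

  split-side : ∀ {xs b} → Split C D xs → b ∈ xs → proj₁ b ⊆ C ⊎ proj₁ b ⊆ D
  split-side (us , vs , P , Q , σ) m =
    Sum.map (block-⊆ P) (block-⊆ Q) (∈-++⁻ us (Perm.∈-resp-↭ (↭-sym σ) m))

  refine : ∀ {us} → Disjoint C D → Partitions A us →
           (∀ {b} → b ∈ us → proj₁ b ⊆ C ⊎ proj₁ b ⊆ D) → Split (A ∩ C) (A ∩ D) us
  refine {C = C} {D} {A} {us} d P side =
    filter (meets? (A ∩ C)) us , filter (meets? (A ∩ D)) us ,
    restrict P ∩-⊆ˡ (inside d side) ,
    restrict P ∩-⊆ˡ (inside (disjoint-sym d) (λ m → Sum.swap (side m))) ,
    filter-split (meets? (A ∩ C)) (meets? (A ∩ D)) us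
      (λ m → Sum.map (meets-trace m) (meets-trace m) (side m))
      (λ m mC mD → disjoint-¬meets (disjoint-sym d)
                     (meets-side d (side m) (meets-mono ∩-⊆ʳ mC)) (meets-mono ∩-⊆ʳ mD))
    where
    inside : ∀ {C D} → Disjoint C D → (∀ {b} → b ∈ us → proj₁ b ⊆ C ⊎ proj₁ b ⊆ D) →
             ∀ {b} → b ∈ us → Meets (proj₁ b) (A ∩ C) → proj₁ b ⊆ A ∩ C
    inside d side m mC = ⊆-∩ (block-⊆ P m) (meets-side d (side m) (meets-mono ∩-⊆ʳ mC))
    meets-trace : ∀ {b C} → b ∈ us → proj₁ b ⊆ C → Meets (proj₁ b) (A ∩ C)
    meets-trace m b⊆C = nonempty-meets (block-nonempty P m) (⊆-∩ (block-⊆ P m) b⊆C)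

  Split₄ : (Ω₁ Ω₂ Ω̃₁ Ω̃₂ : Obj r) → List Block → Set
  Split₄ Ω₁ Ω₂ Ω̃₁ Ω̃₂ xs = ∃[ u₁₁ ] ∃[ u₁₂ ] ∃[ u₂₁ ] ∃[ u₂₂ ]
    (Partitions (Ω₁ ∩ Ω̃₁) u₁₁ × Partitions (Ω₁ ∩ Ω̃₂) u₁₂ ×
     Partitions (Ω₂ ∩ Ω̃₁) u₂₁ × Partitions (Ω₂ ∩ Ω̃₂) u₂₂ ×
     (u₁₁ ++ u₁₂) ++ (u₂₁ ++ u₂₂) ↭ xs)

  splits⇒split₄ : ∀ {xs} → Disjoint Ω̃₁ Ω̃₂ → Split Ω₁ Ω₂ xs → Split Ω̃₁ Ω̃₂ xs →
                  Split₄ Ω₁ Ω₂ Ω̃₁ Ω̃₂ xs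
  splits⇒split₄ d̃ (us , vs , P , Q , σ) s̃ =
    let u₁₁ , u₁₂ , P₁₁ , P₁₂ , σ₁ =
          refine d̃ P (λ m → split-side s̃ (Perm.∈-resp-↭ σ (∈-++⁺ˡ m)))
        u₂₁ , u₂₂ , P₂₁ , P₂₂ , σ₂ =
          refine d̃ Q (λ m → split-side s̃ (Perm.∈-resp-↭ σ (∈-++⁺ʳ us m)))
    in u₁₁ , u₁₂ , u₂₁ , u₂₂ , P₁₁ , P₁₂ , P₂₁ , P₂₂ , ↭-trans (Perm.++⁺ σ₁ σ₂) σ

  split₄⇒splits : ∀ {xs} → Disjoint Ω₁ Ω₂ → Disjoint Ω̃₁ Ω̃₂ → Ω₁ ∪ Ω₂ ≡ Ω̃₁ ∪ Ω̃₂ →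
                  Split₄ Ω₁ Ω₂ Ω̃₁ Ω̃₂ xs → Split Ω₁ Ω₂ xs × Split Ω̃₁ Ω̃₂ xs
  split₄⇒splits {Ω₁ = Ω₁} {Ω₂} d d̃ e (u₁₁ , u₁₂ , u₂₁ , u₂₂ , P₁₁ , P₁₂ , P₂₁ , P₂₂ , σ) =
    (u₁₁ ++ u₁₂ , u₂₁ ++ u₂₂ ,
     subst (λ A → Partitions A _) (cells-left e) (Partitions-++ (disj-row Ω₁ d̃) P₁₁ P₁₂) ,
     subst (λ A → Partitions A _) (cells-right e) (Partitions-++ (disj-row Ω₂ d̃) P₂₁ P₂₂) ,
     σ) ,
    (u₁₁ ++ u₂₁ , u₁₂ ++ u₂₂ ,
     subst (λ A → Partitions A _) (cells-top e) (Partitions-++ (disjoint-∩ d) P₁₁ P₂₁) ,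
     subst (λ A → Partitions A _) (cells-bottom e) (Partitions-++ (disjoint-∩ d) P₁₂ P₂₂) ,
     ↭-trans (++-interchange u₁₁ u₂₁ u₁₂ u₂₂) σ)

  gs : List Block → List Block
  gs = map (gb g)

  gb⁻¹ : Block → Block
  gb⁻¹ (o , y) = o , inv y

  gs⁻¹ : List Block → List Block
  gs⁻¹ = map gb⁻¹

  gs-gs⁻¹ : ∀ L → gs (gs⁻¹ L) ≡ L
  gs-gs⁻¹ []            = refl
  gs-gs⁻¹ ((o , y) ∷ L) = cong₂ (λ y′ L′ → (o , y′) ∷ L′) (fun-inv y) (gs-gs⁻¹ L)

  gs⁻¹-gs : ∀ L → gs⁻¹ (gs L) ≡ L
  gs⁻¹-gs []            = refl
  gs⁻¹-gs ((o , y) ∷ L) = cong₂ (λ y′ L′ → (o , y′) ∷ L′) (inv-fun y) (gs⁻¹-gs L)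

  gE⁻¹ : EG Ω → EG Ω
  gE⁻¹ {Ω} (bs , P) = gs⁻¹ bs , subst (IsPartition Ω) (List.map-∘ bs) P

  blocks-subst : ∀ {Ω′} (e : Ω ≡ Ω′) (x : EG Ω) → blocks (subst EG e x) ≡ blocks x
  blocks-subst refl x = refl

  Image : Disjoint Ω₁ Ω₂ → Ω₁ ∪ Ω₂ ≡ Ω → EG Ω → Set
  Image d e x = ∃[ x₁ ] ∃[ x₂ ] (subst EG e (η g d x₁ x₂) ≈E x)

  image⇔split : (d : Disjoint Ω₁ Ω₂) (e : Ω₁ ∪ Ω₂ ≡ Ω) (x : EG Ω) →
                Image d e x ⇔ Split Ω₁ Ω₂ (blocks x)
  image⇔split d e x = mk⇔
    (λ (x₁ , x₂ , σ) → blocks x₁ , gs (blocks x₂) , proj₂ x₁ , proj₂ (gE g x₂) ,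
                        subst (_↭ blocks x) (blocks-subst e _) σ)
    (λ (us , vs , P , Q , σ) → (us , P) , gE⁻¹ (vs , Q) ,
       subst (_↭ blocks x) (sym (trans (blocks-subst e _) (cong (us ++_) (gs-gs⁻¹ vs)))) σ)

  Refined : Disjoint Ω₁ Ω₂ → Disjoint Ω̃₁ Ω̃₂ → EG Ω → Set
  Refined {Ω₁} {Ω₂} {Ω̃₁} {Ω̃₂} {Ω} d d̃ x =
    Σ[ e′ ∈ ((Ω₁ ∩ Ω̃₁) ∪ (Ω₁ ∩ Ω̃₂)) ∪ ((Ω₂ ∩ Ω̃₁) ∪ (Ω₂ ∩ Ω̃₂)) ≡ Ω ]
      ∃[ x₁₁ ] ∃[ x₁₂ ] ∃[ x₂₁ ] ∃[ x₂₂ ]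
        (subst EG e′ (η g (disj-cols Ω̃₁ Ω̃₂ d)
                        (η g (disj-row Ω₁ d̃) x₁₁ x₁₂)
                        (η g (disj-row Ω₂ d̃) x₂₁ x₂₂)) ≈E x)

  composite-blocks : (d : Disjoint Ω₁ Ω₂) (d̃ : Disjoint Ω̃₁ Ω̃₂) → ∀ x₁₁ x₁₂ x₂₁ x₂₂ →
    blocks (η g (disj-cols Ω̃₁ Ω̃₂ d)
                (η g (disj-row Ω₁ d̃) x₁₁ x₁₂) (η g (disj-row Ω₂ d̃) x₂₁ x₂₂))
      ≡ (blocks x₁₁ ++ gs (blocks x₁₂)) ++ (gs (blocks x₂₁) ++ gs (gs (blocks x₂₂)))
  composite-blocks d d̃ x₁₁ x₁₂ x₂₁ x₂₂ =
    cong (_ ++_) (List.map-++ (gb g) (blocks x₂₁) (gs (blocks x₂₂)))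

  refined⇔split₄ : (d : Disjoint Ω₁ Ω₂) (d̃ : Disjoint Ω̃₁ Ω̃₂) →
                   Ω₁ ∪ Ω₂ ≡ Ω → Ω̃₁ ∪ Ω̃₂ ≡ Ω → (x : EG Ω) →
                   Refined d d̃ x ⇔ Split₄ Ω₁ Ω₂ Ω̃₁ Ω̃₂ (blocks x)
  refined⇔split₄ {Ω₁} {Ω₂} {Ω̃₁} {Ω̃₂} {Ω} d d̃ e ẽ x = mk⇔ refined⇒split₄ split₄⇒refined
    where
    refined⇒split₄ : Refined d d̃ x → Split₄ Ω₁ Ω₂ Ω̃₁ Ω̃₂ (blocks x)
    refined⇒split₄ (e′ , x₁₁ , x₁₂ , x₂₁ , x₂₂ , σ) =
      blocks x₁₁ , gs (blocks x₁₂) , gs (blocks x₂₁) , gs (gs (blocks x₂₂)) ,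
      proj₂ x₁₁ , proj₂ (gE g x₁₂) , proj₂ (gE g x₂₁) , proj₂ (gE g (gE g x₂₂)) ,
      subst (_↭ blocks x)
            (trans (blocks-subst e′ _) (composite-blocks d d̃ x₁₁ x₁₂ x₂₁ x₂₂)) σ

    four-cells : ((Ω₁ ∩ Ω̃₁) ∪ (Ω₁ ∩ Ω̃₂)) ∪ ((Ω₂ ∩ Ω̃₁) ∪ (Ω₂ ∩ Ω̃₂)) ≡ Ω
    four-cells = trans (cong₂ _∪_ (cells-left (trans e (sym ẽ)))
                                  (cells-right (trans e (sym ẽ)))) e

    -- The later components are untwisted by g⁻¹ before composing.
    split₄⇒refined : Split₄ Ω₁ Ω₂ Ω̃₁ Ω̃₂ (blocks x) → Refined d d̃ x
    split₄⇒refined (u₁₁ , u₁₂ , u₂₁ , u₂₂ , P₁₁ , P₁₂ , P₂₁ , P₂₂ , σ) =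
      four-cells , x₁₁ , x₁₂ , x₂₁ , x₂₂ , subst (_↭ blocks x) (sym untwisted) σ
      where
      x₁₁ : EG (Ω₁ ∩ Ω̃₁)
      x₁₁ = u₁₁ , P₁₁
      x₁₂ : EG (Ω₁ ∩ Ω̃₂)
      x₁₂ = gE⁻¹ (u₁₂ , P₁₂)
      x₂₁ : EG (Ω₂ ∩ Ω̃₁)
      x₂₁ = gE⁻¹ (u₂₁ , P₂₁)
      x₂₂ : EG (Ω₂ ∩ Ω̃₂)
      x₂₂ = gE⁻¹ (gE⁻¹ (u₂₂ , P₂₂))
      composite : EG (((Ω₁ ∩ Ω̃₁) ∪ (Ω₁ ∩ Ω̃₂)) ∪ ((Ω₂ ∩ Ω̃₁) ∪ (Ω₂ ∩ Ω̃₂)))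
      composite = η g (disj-cols Ω̃₁ Ω̃₂ d)
                    (η g (disj-row Ω₁ d̃) x₁₁ x₁₂) (η g (disj-row Ω₂ d̃) x₂₁ x₂₂)
      untwisted : blocks (subst EG four-cells composite) ≡ (u₁₁ ++ u₁₂) ++ (u₂₁ ++ u₂₂)
      untwisted = begin
        blocks (subst EG four-cells composite)
          ≡⟨ blocks-subst four-cells composite ⟩
        blocks composite
          ≡⟨ composite-blocks d d̃ x₁₁ x₁₂ x₂₁ x₂₂ ⟩
        (u₁₁ ++ gs (gs⁻¹ u₁₂)) ++ (gs (gs⁻¹ u₂₁) ++ gs (gs (gs⁻¹ (gs⁻¹ u₂₂))))
          ≡⟨ cong₂ (λ a b → (u₁₁ ++ a) ++ b) (gs-gs⁻¹ u₁₂)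
                   (cong₂ _++_ (gs-gs⁻¹ u₂₁)
                               (trans (cong gs (gs-gs⁻¹ (gs⁻¹ u₂₂))) (gs-gs⁻¹ u₂₂))) ⟩
        (u₁₁ ++ u₁₂) ++ (u₂₁ ++ u₂₂)
          ∎
        where open ≡-Reasoning

  D1 : (d : Disjoint Ω₁ Ω₂) (d̃ : Disjoint Ω̃₁ Ω̃₂) (e : Ω₁ ∪ Ω₂ ≡ Ω) (ẽ : Ω̃₁ ∪ Ω̃₂ ≡ Ω)
       (x : EG Ω) → (Image d e x × Image d̃ ẽ x) ⇔ Refined d d̃ x
  D1 d d̃ e ẽ x =
    ⇔.trans (image⇔split d e x ×-⇔ image⇔split d̃ ẽ x)
    (⇔.trans (mk⇔ (λ (s , s̃) → splits⇒split₄ d̃ s s̃) (split₄⇒splits d d̃ (trans e (sym ẽ))))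
             (⇔.sym (refined⇔split₄ d d̃ e ẽ x)))

  η-well-defined : (d : Disjoint Ω₁ Ω₂) {x₁ x₁′ : EG Ω₁} {x₂ x₂′ : EG Ω₂} →
                   x₁ ≈E x₁′ → x₂ ≈E x₂′ → η g d x₁ x₂ ≈E η g d x₁′ x₂′
  η-well-defined d σ₁ σ₂ = Perm.++⁺ σ₁ (Perm.map⁺ (gb g) σ₂)

  -- η is injective: the split of η(x₁ , x₂) along (Ω₁ , Ω₂) is unique.
  η-injective : (d : Disjoint Ω₁ Ω₂) {x₁ x₁′ : EG Ω₁} {x₂ x₂′ : EG Ω₂} →
                η g d x₁ x₂ ≈E η g d x₁′ x₂′ → (x₁ ≈E x₁′) × (x₂ ≈E x₂′)
  η-injective d {x₁} {x₁′} {x₂} {x₂′} σ =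
    let σ₁ , σ₂ = cancel-partitions d (proj₂ x₁) (proj₂ (gE g x₂))
                                      (proj₂ x₁′) (proj₂ (gE g x₂′)) σ
    in σ₁ , subst₂ _↭_ (gs⁻¹-gs (blocks x₂)) (gs⁻¹-gs (blocks x₂′)) (Perm.map⁺ gb⁻¹ σ₂)

  transport-unique : ∀ {o A B} (q : Mor o A) (q′ : Mor o B) → AgreeOn o (to q) (to q′) →
                     (y : F o) → _≡_ {A = Block} (A , mapᴳ q y) (B , mapᴳ q′ y)
  transport-unique q q′ agree y with refl ← codomain-unique q q′ agree =
    cong (_ ,_) (map-cong q q′ agree y)

  BlockRel-unique : ∀ {Ω Ω′ Ω″ Ω‴} (f : Mor Ω Ω′) (f′ : Mor Ω″ Ω‴) {b c c′} →
                    AgreeOn (proj₁ b) (to f) (to f′) →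
                    BlockRel f b c → BlockRel f′ b c′ → c ≡ c′
  BlockRel-unique f f′ {o , y} agree (q , q≈f , refl) (q′ , q′≈f′ , refl) =
    transport-unique q q′ q≈q′ y
    where
    q≈q′ : AgreeOn o (to q) (to q′)
    q≈q′ i n p = trans (q≈f i n p) (trans (agree i n p) (sym (q′≈f′ i n p)))

  Pointwise-unique : ∀ {Ω Ω′ Ω″ Ω‴} (f : Mor Ω Ω′) (f′ : Mor Ω″ Ω‴) {bs L L′} →
                     (∀ {b} → b ∈ bs → AgreeOn (proj₁ b) (to f) (to f′)) →
                     Pointwise (BlockRel f) bs L → Pointwise (BlockRel f′) bs L′ → L ≡ L′
  Pointwise-unique f f′ agree []       []         = refl
  Pointwise-unique f f′ agree (r ∷ rs) (r′ ∷ rs′) =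
    cong₂ _∷_ (BlockRel-unique f f′ (agree (here refl)) r r′)
              (Pointwise-unique f f′ (λ m → agree (there m)) rs rs′)

  BlockRel-twist : ∀ {Ω Ω′} (f : Mor Ω Ω′) {b c} → BlockRel f b c → BlockRel f (gb g b) (gb g c)
  BlockRel-twist f {o , y} (q , q≈f , mapped) =
    q , q≈f , trans (sym (natural q y)) (cong fun mapped)

  η-natural : ∀ {Ω̃₁ Ω̃₂} (d : Disjoint Ω₁ Ω₂) (d̃ : Disjoint Ω̃₁ Ω̃₂)
              (f₁ : Mor Ω₁ Ω̃₁) (f₂ : Mor Ω₂ Ω̃₂) (h : Mor (Ω₁ ∪ Ω₂) (Ω̃₁ ∪ Ω̃₂)) →
              AgreeOn Ω₁ (to h) (to f₁) → AgreeOn Ω₂ (to h) (to f₂) →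
              ∀ x₁ x₂ y₁ y₂ z → EMap f₁ x₁ y₁ → EMap f₂ x₂ y₂ →
              EMap h (η g d x₁ x₂) z → z ≈E η g d̃ y₁ y₂
  η-natural d d̃ f₁ f₂ h h≈f₁ h≈f₂ x₁ x₂ y₁ y₂ z
            (L₁ , rel₁ , σ₁) (L₂ , rel₂ , σ₂) (L , rel , σ)
    with L₁′ , L₂′ , refl , rel₁′ , rel₂′ ← pointwise-++⁻ (blocks x₁) (gs (blocks x₂)) rel =
    begin
      blocks z          ↭⟨ σ ⟨
      L₁′ ++ L₂′        ≡⟨ cong₂ _++_ L₁′≡L₁ L₂′≡gL₂ ⟩
      L₁ ++ gs L₂       ↭⟨ Perm.++⁺ σ₁ (Perm.map⁺ (gb g) σ₂) ⟩
      blocks (η g d̃ y₁ y₂) ∎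
    where
    open PermutationReasoning
    L₁′≡L₁ : L₁′ ≡ L₁
    L₁′≡L₁ = Pointwise-unique h f₁
      (λ m i n p → h≈f₁ i n (block-⊆ (proj₂ x₁) m i n p)) rel₁′ rel₁
    L₂′≡gL₂ : L₂′ ≡ gs L₂
    L₂′≡gL₂ = Pointwise-unique h f₂
      (λ m i n p → h≈f₂ i n (block-⊆ (proj₂ (gE g x₂)) m i n p)) rel₂′
      (Pointwise.map⁺ (gb g) (gb g) (Pointwise.map (BlockRel-twist f₂) rel₂))

  isCompositionOperator : IsCompositionOperator EG _≈E_ EMap (η g)
  isCompositionOperator = record
    { well-defined = η-well-defined
    ; injective    = η-injective
    ; naturality   = η-natural
    ; D1           = D1
    }

-- Theorem 9.4.
theorem9p4 : ∀ {c ℓ} (r : ℕ) → 1 ≤ r → (Λ : CommutativeRing c ℓ) →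
    (G : WeightedSpecies r Λ) (g : SpeciesIso (WeightedSpecies.species G)) →
    WeightPreserving G g →
    IsCompositionOperator
      (E.EG (WeightedSpecies.species G))
      (E._≈E_ (WeightedSpecies.species G))
      (E.EMap (WeightedSpecies.species G))
      (E.η (WeightedSpecies.species G) g)
theorem9p4 r _ Λ G g _ = CompositionOfE.isCompositionOperator (WeightedSpecies.species G) g
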